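{- Let $r\ge 2$ and, for $m\ge 1$, let $P_{m,r}(x,y,z)=\xi(P_{m,r};x,y,z)$ be the hyperedge elimination polynomial of the $r$-uniform elementary path hypergraph $P_{m,r}$ with $m$ edges, and set $P_{0,r}(x,y,z)=1$. Then for every $m>2$, $$P_{m,r}(x,y,z)=(x^{r-1}+y)\,P_{m-1,r}(x,y,z)+z\,x^{r-2}\,P_{m-2,r}(x,y,z).$$
   Context: $P_{m,r}$ has edges $e_1,\dots,e_m$, each with exactly $r$ vertices, such that $|e_i\cap e_{i+1}|=1$ for $1\le i\le m-1$ and the edges are otherwise pairwise disjoint (non-consecutive edges are disjoint, and the vertex set is the union of the edges). For a hypergraph $H=(V,E)$ with edge family $(e_i)_{i\in I}$: for $J\subseteq I$, $H_J=(V,(e_j)_{j\in J})$ is the partial hypergraph and $H\times J$ the edge section hypergraph with vertex set $\bigcup_{j\in J}e_j$ and edges $(e_j)_{j\in J}$; $k(G)$ is the number of connected components of $G$ (a hypergraph without vertices has $0$); a pair $(A,B)$ of disjoint subsets of $I$ is vertex disjoint if $e_a\cap e_b=\emptyset$ for all $a\in A,b\in B$; and $\xi(H;x,y,z)=\sum_{(A,B)}x^{k(H_{A\sqcup B})-k(H\times B)}y^{|A|+|B|-k(H\times B)}z^{k(H\times B)}$ summed over vertex disjoint pairs. -}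

module Defs where

open import Level using (Level)
open import Data.Bool using (Bool; true; false; _∧_; _∨_; not; if_then_else_)
open import Data.Nat using (ℕ; zero; suc; _∸_; _≤ᵇ_; _<ᵇ_) renaming (_+_ to _+ℕ_; _*_ to _*ℕ_)
open import Data.Fin using (Fin; toℕ; _≟_)
import Data.Fin as Fin
open import Data.Vec using (Vec; []; _∷_; tabulate; lookup; replicate; zipWith)
open import Data.List using (List; []; _∷_; _++_)
import Data.List as List
open import Relation.Nullary.Decidable using (⌊_⌋)
open import Algebra.Bundles using (CommutativeRing)
import Algebra.Bundles
import Algebra.Definitions.RawSemiring as RS

-- Finite sets of vertices {0,…,n-1} as bit vectors (same representation
-- as Data.Fin.Subset, but with Bool-valued operations so that everything
-- is computable).

VSet : ℕ → Set
VSet n = Vec Bool n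

∅ : ∀ {n} → VSet n
∅ = replicate _ false

singleton : ∀ {n} → Fin n → VSet n
singleton v = tabulate (λ w → ⌊ w ≟ v ⌋)

_∪_ : ∀ {n} → VSet n → VSet n → VSet n
_∪_ = zipWith _∨_

_∩_ : ∀ {n} → VSet n → VSet n → VSet n
_∩_ = zipWith _∧_

nonEmpty : ∀ {n} → VSet n → Bool
nonEmpty []       = false
nonEmpty (b ∷ bs) = b ∨ nonEmpty bs

meets : ∀ {n} → VSet n → VSet n → Bool
meets e f = nonEmpty (e ∩ f)

⋃ : ∀ {n} → List (VSet n) → VSet n
⋃ []       = ∅
⋃ (e ∷ es) = e ∪ ⋃ es

step : ∀ {n} → List (VSet n) → VSet n → VSet n
step []       S = S
step (e ∷ es) S = (if meets e S then e else ∅) ∪ step es S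

iter : ∀ {A : Set} → ℕ → (A → A) → A → A
iter zero    f a = a
iter (suc k) f a = f (iter k f a)

-- vertex set of the connected component of v (n closure steps suffice)
component : ∀ {n} → List (VSet n) → Fin n → VSet n
component {n} E v = iter n (step E) (singleton v)

isRep : ∀ {n} → List (VSet n) → Fin n → Bool
isRep {n} E v = not (nonEmpty (tabulate (λ w → (toℕ w <ᵇ toℕ v) ∧ lookup (component E v) w)))

countᵇ : ∀ {n} → (Fin n → Bool) → ℕ
countᵇ {zero}  p = 0
countᵇ {suc n} p = (if p Fin.zero then 1 else 0) +ℕ countᵇ (λ i → p (Fin.suc i))

-- k(G): number of connected components of the hypergraph (V , E)
-- = number of vertices of V that are least in their component.
k : ∀ {n} → VSet n → List (VSet n) → ℕ
k V E = countᵇ (λ v → lookup V v ∧ isRep E v)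

record Hypergraph : Set where
  constructor hyp
  field
    n    : ℕ
    m    : ℕ
    edge : Fin m → VSet n

-- a pair (A,B) of disjoint subsets of the index set is encoded by a
-- labelling of the indices
data Label : Set where
  none inA inB : Label

allLabellings : (m : ℕ) → List (Fin m → Label)
allLabellings zero    = (λ ()) ∷ []
allLabellings (suc m) =
  List.concatMap (λ f → List.map (λ l → cons l f) (none ∷ inA ∷ inB ∷ []))
                 (allLabellings m)
  where
  cons : Label → (Fin m → Label) → Fin (suc m) → Label
  cons l f Fin.zero    = l
  cons l f (Fin.suc i) = f i

isA isB isAB : Label → Bool
isA inA = true
isA _   = false
isB inB = true
isB _   = false
isAB none = false
isAB _    = true

selectEdges : ∀ {n} m → (Fin m → VSet n) → (Fin m → Bool) → List (VSet n)
selectEdges zero    e p = []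
selectEdges (suc m) e p =
  (if p Fin.zero then (e Fin.zero ∷ []) else [])
  ++ selectEdges m (λ i → e (Fin.suc i)) (λ i → p (Fin.suc i))

allFinᵇ : ∀ m → (Fin m → Bool) → Bool
allFinᵇ zero    p = true
allFinᵇ (suc m) p = p Fin.zero ∧ allFinᵇ m (λ i → p (Fin.suc i))

module _ (H : Hypergraph) where
  open Hypergraph H

  vertexDisjoint : (Fin m → Label) → Bool
  vertexDisjoint f =
    allFinᵇ m (λ a → allFinᵇ m (λ b →
      not (isA (f a) ∧ isB (f b) ∧ meets (edge a) (edge b))))

  edgesA⊔B edgesB : (Fin m → Label) → List (VSet n)
  edgesA⊔B f = selectEdges m edge (λ i → isAB (f i))
  edgesB   f = selectEdges m edge (λ i → isB (f i))

  kPartial : (Fin m → Label) → ℕ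
  kPartial f = k (replicate _ true) (edgesA⊔B f)

  kSection : (Fin m → Label) → ℕ
  kSection f = k (⋃ (edgesB f)) (edgesB f)

  sizeAB : (Fin m → Label) → ℕ
  sizeAB f = countᵇ (λ i → isAB (f i))

-- The hyperedge elimination polynomial, evaluated in an arbitrary
-- commutative ring (a polynomial identity over ℤ[x,y,z] is the same as
-- an identity holding for all x,y,z in all commutative rings).

module Poly {c ℓ : Level} (R : CommutativeRing c ℓ) where
  open CommutativeRing R
  open RS (Algebra.Bundles.Semiring.rawSemiring semiring) public using (_^_)

  sumL : List Carrier → Carrier
  sumL []       = 0#
  sumL (a ∷ as) = a + sumL as

  ξ : Hypergraph → Carrier → Carrier → Carrier → Carrier
  ξ H x y z =
    sumL (List.map term (allLabellings (Hypergraph.m H)))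
    where
    term : (Fin (Hypergraph.m H) → Label) → Carrier
    term f = if vertexDisjoint H f
             then (x ^ (kPartial H f ∸ kSection H f))
                  * (y ^ (sizeAB H f ∸ kSection H f))
                  * (z ^ kSection H f)
             else 0#

-- Consecutive edges share exactly the vertex (i+1)(r-1); others are disjoint.

pathHyp : (m r : ℕ) → Hypergraph
pathHyp m r = hyp (suc (m *ℕ (r ∸ 1))) m edge
  where
  edge : Fin m → VSet (suc (m *ℕ (r ∸ 1)))
  edge i = tabulate (λ v → (toℕ i *ℕ (r ∸ 1) ≤ᵇ toℕ v)
                         ∧ (toℕ v ≤ᵇ toℕ i *ℕ (r ∸ 1) +ℕ (r ∸ 1)))

module PathPoly {c ℓ : Level} (R : CommutativeRing c ℓ) where
  open CommutativeRing R
  open Poly R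

  P : (m r : ℕ) → Carrier → Carrier → Carrier → Carrier
  P zero    r x y z = 1#
  P (suc m) r x y z = ξ (pathHyp (suc m) r) x y z

-- Sort the summands of ξ(P_{m,r}) by the labels (unused, A or B) of the first two edges. Components
-- of partial hypergraphs of a path are intervals, so k(H_{A⊔B}) and k(H × B) count the vertices that
-- no selected edge contains together with their predecessor, and deleting edge 0 changes the three
-- exponents by amounts depending only on those two labels. If edge 0 is unused, its r - 1 vertices
-- not shared with edge 1 are isolated: a factor x^{r-1}. If edge 0 is in A and edge 1 is not in B,
-- or both are in B, edge 0 joins an existing component and only |A| + |B| grows: a factor y. If edge 0
-- is in B and edge 1 is unused, edge 0 is a new component of H × B with r - 2 private vertices: a
-- factor z x^{r-2} in front of the path from edge 2 on. The pairs (A,B) and (B,A) are not vertex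
-- disjoint. The y-terms reassemble ξ(P_{m-1,r}).

module Submission where

open import Defs
open import Level using (Level)
open import Algebra.Bundles using (CommutativeRing)
open import Data.Bool using (Bool; true; false; _∧_; _∨_; not; if_then_else_)
open import Data.Fin using (Fin; toℕ) renaming (zero to fz; suc to fs)
open import Data.List using (List; []; _∷_; _++_)
open import Data.Nat using (ℕ; zero; suc; _∸_; _≤_; _<_; z≤n; s≤s)
open import Data.Vec.Functional using (tail) renaming (_∷_ to _∷ᶠ_)
open import Function.Base using (_∘_)

module Combinatorics where

  open import Data.Bool using (T)
  open import Data.Bool.Properties using (T-≡; ⇔→≡; ∧-assoc; ∨-zeroʳ; ∨-identityʳ; ∧-zeroʳ; ∧-identityʳ)
  open import Data.Empty using (⊥-elim)
  open import Data.Fin using (fromℕ<; _≟_)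
  open import Data.Fin.Properties using (toℕ-fromℕ<; toℕ<n)
  open import Data.List.Membership.Propositional using (_∈_)
  open import Data.List.Relation.Unary.Any using (here; there)
  open import Data.Nat using (_+_; _*_; _≤ᵇ_; _<ᵇ_; z<s; s<s; _≤?_)
  open import Data.Nat.Properties hiding (_≟_)
  open import Data.Product using (∃-syntax; _×_; _,_)
  open import Data.Sum using (_⊎_; inj₁; inj₂; map₂)
  open import Data.Vec using ([]; _∷_; tabulate; lookup)
  open import Data.Vec.Properties using (lookup-zipWith; lookup-replicate; lookup∘tabulate)
  open import Function.Bundles using (Equivalence; mk⇔)
  open import Relation.Nullary using (¬_; yes; no)
  open import Relation.Nullary.Decidable using (⌊_⌋)
  open import Relation.Binary.PropositionalEquality

  private
    variable
      a b : Bool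
      m n : ℕ

  ≡true⇒T : a ≡ true → T a
  ≡true⇒T = Equivalence.from T-≡

  ≤⇒≤ᵇ≡true : m ≤ n → (m ≤ᵇ n) ≡ true
  ≤⇒≤ᵇ≡true m≤n = Equivalence.to T-≡ (≤⇒≤ᵇ m≤n)

  ≤ᵇ≡true⇒≤ : (m ≤ᵇ n) ≡ true → m ≤ n
  ≤ᵇ≡true⇒≤ {m} {n} eq = ≤ᵇ⇒≤ m n (≡true⇒T eq)

  ≰⇒≤ᵇ≡false : ¬ m ≤ n → (m ≤ᵇ n) ≡ false
  ≰⇒≤ᵇ≡false {m} {n} m≰n with m ≤ᵇ n in eq
  ... | true  = ⊥-elim (m≰n (≤ᵇ≡true⇒≤ eq))
  ... | false = refl

  <⇒<ᵇ≡true : m < n → (m <ᵇ n) ≡ true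
  <⇒<ᵇ≡true m<n = Equivalence.to T-≡ (<⇒<ᵇ m<n)

  <ᵇ≡true⇒< : (m <ᵇ n) ≡ true → m < n
  <ᵇ≡true⇒< {m} {n} eq = <ᵇ⇒< m n (≡true⇒T eq)

  ≮⇒<ᵇ≡false : ¬ m < n → (m <ᵇ n) ≡ false
  ≮⇒<ᵇ≡false {m} {n} m≮n with m <ᵇ n in eq
  ... | true  = ⊥-elim (m≮n (<ᵇ≡true⇒< eq))
  ... | false = refl

  ∧≡true⇒ˡ : a ∧ b ≡ true → a ≡ true
  ∧≡true⇒ˡ {true} _ = refl

  ∧≡true⇒ʳ : a ∧ b ≡ true → b ≡ true
  ∧≡true⇒ʳ {true} eq = eq

  ∨≡true⇒⊎ : a ∨ b ≡ true → a ≡ true ⊎ b ≡ true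
  ∨≡true⇒⊎ {true}  _  = inj₁ refl
  ∨≡true⇒⊎ {false} eq = inj₂ eq

  <ᵇ-suc : ∀ m n → (m <ᵇ suc n) ≡ (m ≤ᵇ n)
  <ᵇ-suc zero    n = refl
  <ᵇ-suc (suc m) n = refl

  +-cancelˡ-<ᵇ : ∀ k m n → (k + m <ᵇ k + n) ≡ (m <ᵇ n)
  +-cancelˡ-<ᵇ zero    m n = refl
  +-cancelˡ-<ᵇ (suc k) m n = +-cancelˡ-<ᵇ k m n

  +-cancelˡ-≤ᵇ : ∀ k m n → (k + m ≤ᵇ k + n) ≡ (m ≤ᵇ n)
  +-cancelˡ-≤ᵇ zero    m n = refl
  +-cancelˡ-≤ᵇ (suc k) m n = trans (<ᵇ-suc (k + m) (k + n)) (+-cancelˡ-≤ᵇ k m n)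

  indicator : Bool → ℕ
  indicator b = if b then 1 else 0

  countBelow : ℕ → (ℕ → Bool) → ℕ
  countBelow zero    q = 0
  countBelow (suc n) q = indicator (q 0) + countBelow n (λ v → q (suc v))

  countᵇ-toℕ : ∀ n (q : ℕ → Bool) → countᵇ {n} (λ v → q (toℕ v)) ≡ countBelow n q
  countᵇ-toℕ zero    q = refl
  countᵇ-toℕ (suc n) q = cong (indicator (q 0) +_) (countᵇ-toℕ n (λ v → q (suc v)))

  countᵇ-cong : {p q : Fin n → Bool} → (∀ i → p i ≡ q i) → countᵇ p ≡ countᵇ q
  countᵇ-cong {zero}  _  = refl
  countᵇ-cong {suc n} eq = cong₂ _+_ (cong indicator (eq fz)) (countᵇ-cong (λ i → eq (fs i)))

  countBelow-+ : ∀ m n q → countBelow (m + n) q ≡ countBelow m q + countBelow n (λ v → q (m + v))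
  countBelow-+ zero    n q = refl
  countBelow-+ (suc m) n q =
    trans (cong (indicator (q 0) +_) (countBelow-+ m n (λ v → q (suc v))))
          (sym (+-assoc (indicator (q 0)) _ _))

  countBelow-cong : ∀ n {p q : ℕ → Bool} → (∀ v → v < n → p v ≡ q v) → countBelow n p ≡ countBelow n q
  countBelow-cong zero    eq = refl
  countBelow-cong (suc n) eq =
    cong₂ _+_ (cong indicator (eq 0 z<s)) (countBelow-cong n (λ v v<n → eq (suc v) (s<s v<n)))

  countBelow-true : ∀ n → countBelow n (λ _ → true) ≡ n
  countBelow-true zero    = refl
  countBelow-true (suc n) = cong suc (countBelow-true n)

  countBelow-false : ∀ n → countBelow n (λ _ → false) ≡ 0
  countBelow-false zero    = refl
  countBelow-false (suc n) = countBelow-false n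

  anyFinᵇ : ∀ m → (Fin m → Bool) → Bool
  anyFinᵇ zero    p = false
  anyFinᵇ (suc m) p = p fz ∨ anyFinᵇ m (λ i → p (fs i))

  anyFinᵇ⁺ : ∀ m (p : Fin m → Bool) i → p i ≡ true → anyFinᵇ m p ≡ true
  anyFinᵇ⁺ (suc m) p fz     eq rewrite eq = refl
  anyFinᵇ⁺ (suc m) p (fs i) eq rewrite anyFinᵇ⁺ m (λ j → p (fs j)) i eq = ∨-zeroʳ (p fz)

  anyFinᵇ⁻ : ∀ m (p : Fin m → Bool) → anyFinᵇ m p ≡ true → ∃[ i ] p i ≡ true
  anyFinᵇ⁻ (suc m) p eq with ∨≡true⇒⊎ {p fz} eq
  ... | inj₁ p0 = fz , p0
  ... | inj₂ ps with anyFinᵇ⁻ m (λ i → p (fs i)) ps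
  ...   | i , pi = fs i , pi

  anyFinᵇ-cong : ∀ m {p q : Fin m → Bool} → (∀ i → p i ≡ q i) → anyFinᵇ m p ≡ anyFinᵇ m q
  anyFinᵇ-cong zero    eq = refl
  anyFinᵇ-cong (suc m) eq = cong₂ _∨_ (eq fz) (anyFinᵇ-cong m (λ i → eq (fs i)))

  anyFinᵇ-false : ∀ m (p : Fin m → Bool) → (∀ i → p i ≡ false) → anyFinᵇ m p ≡ false
  anyFinᵇ-false zero    p eq = refl
  anyFinᵇ-false (suc m) p eq rewrite eq fz = anyFinᵇ-false m _ (λ i → eq (fs i))

  allFinᵇ-cong : ∀ m {p q : Fin m → Bool} → (∀ i → p i ≡ q i) → allFinᵇ m p ≡ allFinᵇ m q
  allFinᵇ-cong zero    eq = refl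
  allFinᵇ-cong (suc m) eq = cong₂ _∧_ (eq fz) (allFinᵇ-cong m (λ i → eq (fs i)))

  allFinᵇ-true : ∀ m (p : Fin m → Bool) → (∀ i → p i ≡ true) → allFinᵇ m p ≡ true
  allFinᵇ-true zero    p eq = refl
  allFinᵇ-true (suc m) p eq rewrite eq fz = allFinᵇ-true m _ (λ i → eq (fs i))

  allFinᵇ-∧ : ∀ m (p q : Fin m → Bool) → allFinᵇ m (λ i → p i ∧ q i) ≡ allFinᵇ m p ∧ allFinᵇ m q
  allFinᵇ-∧ zero    p q = refl
  allFinᵇ-∧ (suc m) p q with p fz | q fz
  ... | true  | true  = allFinᵇ-∧ m _ _
  ... | true  | false = sym (∧-zeroʳ (allFinᵇ m (λ i → p (fs i))))
  ... | false | _     = refl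

  infix 4 _∈ᵥ_
  _∈ᵥ_ : Fin n → VSet n → Set
  v ∈ᵥ S = lookup S v ≡ true

  lookup-∪ : ∀ (S S′ : VSet n) v → lookup (S ∪ S′) v ≡ lookup S v ∨ lookup S′ v
  lookup-∪ S S′ v = lookup-zipWith _∨_ v S S′

  lookup-∩ : ∀ (S S′ : VSet n) v → lookup (S ∩ S′) v ≡ lookup S v ∧ lookup S′ v
  lookup-∩ S S′ v = lookup-zipWith _∧_ v S S′

  lookup-∅ : ∀ (v : Fin n) → lookup ∅ v ≡ false
  lookup-∅ v = lookup-replicate v false

  ∈ᵥ-singleton : ∀ (v : Fin n) → v ∈ᵥ singleton v
  ∈ᵥ-singleton v with v ≟ v | lookup∘tabulate (λ w → ⌊ w ≟ v ⌋) v
  ... | yes _  | eq = eq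
  ... | no v≢v | _  = ⊥-elim (v≢v refl)

  ∈ᵥ-singleton⁻ : ∀ {v w : Fin n} → w ∈ᵥ singleton v → w ≡ v
  ∈ᵥ-singleton⁻ {v = v} {w} w∈ with w ≟ v | lookup∘tabulate (λ u → ⌊ u ≟ v ⌋) w
  ... | yes w≡v | _  = w≡v
  ... | no _    | eq with () ← trans (sym eq) w∈

  nonEmpty⁺ : ∀ (S : VSet n) v → v ∈ᵥ S → nonEmpty S ≡ true
  nonEmpty⁺ (b ∷ S) fz     v∈ rewrite v∈ = refl
  nonEmpty⁺ (b ∷ S) (fs v) v∈ rewrite nonEmpty⁺ S v v∈ = ∨-zeroʳ b

  nonEmpty⁻ : ∀ (S : VSet n) → nonEmpty S ≡ true → ∃[ v ] v ∈ᵥ S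
  nonEmpty⁻ (b ∷ S) eq with ∨≡true⇒⊎ {b} eq
  ... | inj₁ b≡true = fz , b≡true
  ... | inj₂ ne with nonEmpty⁻ S ne
  ...   | v , v∈ = fs v , v∈

  nonEmpty-false : ∀ (S : VSet n) → (∀ v → lookup S v ≡ false) → nonEmpty S ≡ false
  nonEmpty-false []      _  = refl
  nonEmpty-false (b ∷ S) eq rewrite eq fz = nonEmpty-false S (λ v → eq (fs v))

  meets⁺ : ∀ (e S : VSet n) v → v ∈ᵥ e → v ∈ᵥ S → meets e S ≡ true
  meets⁺ e S v v∈e v∈S = nonEmpty⁺ (e ∩ S) v (trans (lookup-∩ e S v) (cong₂ _∧_ v∈e v∈S))

  meets⁻ : ∀ {e S : VSet n} → meets e S ≡ true → ∃[ v ] v ∈ᵥ e × v ∈ᵥ S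
  meets⁻ {e = e} {S} eq with nonEmpty⁻ (e ∩ S) eq
  ... | v , v∈ = let v∈′ = trans (sym (lookup-∩ e S v)) v∈ in v , ∧≡true⇒ˡ v∈′ , ∧≡true⇒ʳ {lookup e v} v∈′

  step-⊇ : ∀ (E : List (VSet n)) {S} v → v ∈ᵥ S → v ∈ᵥ step E S
  step-⊇ []      v v∈ = v∈
  step-⊇ (e ∷ E) {S} v v∈
    rewrite lookup-∪ (if meets e S then e else ∅) (step E S) v | step-⊇ E {S} v v∈ = ∨-zeroʳ _

  step-edge : ∀ {E : List (VSet n)} {S e} v → e ∈ E → meets e S ≡ true → v ∈ᵥ e → v ∈ᵥ step E S
  step-edge {E = e ∷ E} {S} v (here refl) meets-eS v∈e
    rewrite lookup-∪ (if meets e S then e else ∅) (step E S) v | meets-eS | v∈e = refl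
  step-edge {E = e′ ∷ E} {S} v (there e∈E) meets-eS v∈e
    rewrite lookup-∪ (if meets e′ S then e′ else ∅) (step E S) v | step-edge {E = E} {S} v e∈E meets-eS v∈e = ∨-zeroʳ _

  step⁻ : ∀ (E : List (VSet n)) {S} v → v ∈ᵥ step E S →
          v ∈ᵥ S ⊎ ∃[ e ] e ∈ E × meets e S ≡ true × v ∈ᵥ e
  step⁻ []      v v∈ = inj₁ v∈
  step⁻ (e ∷ E) {S} v v∈ rewrite lookup-∪ (if meets e S then e else ∅) (step E S) v
    with ∨≡true⇒⊎ {lookup (if meets e S then e else ∅) v} v∈
  ... | inj₂ v∈step = map₂ (λ (e′ , e′∈ , rest) → e′ , there e′∈ , rest) (step⁻ E v v∈step)
  ... | inj₁ v∈added with meets e S in meets-eS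
  ...   | true  = inj₂ (e , here refl , meets-eS , v∈added)
  ...   | false with () ← trans (sym (lookup-∅ v)) v∈added

  iter-step-⊇ : ∀ (E : List (VSet n)) k {S} v → v ∈ᵥ S → v ∈ᵥ iter k (step E) S
  iter-step-⊇ E zero    v v∈ = v∈
  iter-step-⊇ E (suc k) v v∈ = step-⊇ E v (iter-step-⊇ E k v v∈)

  isRep-false : ∀ {E : List (VSet n)} {e v w} → e ∈ E → v ∈ᵥ e → w ∈ᵥ e → toℕ w < toℕ v → isRep E v ≡ false
  isRep-false {suc n} {E} {e} {v} {w} e∈E v∈e w∈e w<v =
    cong not (nonEmpty⁺ (tabulate below) w (trans (lookup∘tabulate below w) (cong₂ _∧_ (<⇒<ᵇ≡true w<v) w∈comp)))
    where
    below : Fin (suc n) → Bool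
    below u = (toℕ u <ᵇ toℕ v) ∧ lookup (component E v) u
    w∈comp : w ∈ᵥ component E v
    w∈comp = step-edge w e∈E (meets⁺ e _ v v∈e (iter-step-⊇ E n v (∈ᵥ-singleton v))) w∈e

  isRep-true : ∀ {E : List (VSet n)} {v} →
               (∀ {e u w} → e ∈ E → u ∈ᵥ e → w ∈ᵥ e → toℕ w < toℕ v → toℕ u < toℕ v) →
               isRep E v ≡ true
  isRep-true {n} {E} {v} closed =
    cong not (nonEmpty-false (tabulate below) (λ w → trans (lookup∘tabulate below w) (not-below w)))
    where
    below : Fin n → Bool
    below u = (toℕ u <ᵇ toℕ v) ∧ lookup (component E v) u
    AboveV : VSet n → Set
    AboveV S = ∀ w → w ∈ᵥ S → toℕ v ≤ toℕ w
    step-above : ∀ {S} → AboveV S → AboveV (step E S)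
    step-above {S} above w w∈ with step⁻ E w w∈
    ... | inj₁ w∈S = above w w∈S
    ... | inj₂ (e , e∈E , meets-eS , w∈e) with meets⁻ {e = e} meets-eS | toℕ v ≤? toℕ w
    ...   | _           | yes v≤w = v≤w
    ...   | u , u∈e , u∈S | no v≰w = ⊥-elim (<⇒≱ (closed e∈E u∈e w∈e (≰⇒> v≰w)) (above u u∈S))
    iter-above : ∀ k → AboveV (iter k (step E) (singleton v))
    iter-above zero    w w∈ = ≤-reflexive (cong toℕ (sym (∈ᵥ-singleton⁻ w∈)))
    iter-above (suc k) = step-above (iter-above k)
    not-below : ∀ w → below w ≡ false
    not-below w with lookup (component E v) w in w∈
    ... | true  = trans (∧-identityʳ _) (≮⇒<ᵇ≡false (λ w<v → <⇒≱ w<v (iter-above n w w∈)))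
    ... | false = ∧-zeroʳ _

  selectEdges⁺ : ∀ m (e : Fin m → VSet n) p i → p i ≡ true → e i ∈ selectEdges m e p
  selectEdges⁺ (suc m) e p fz     pi rewrite pi = here refl
  selectEdges⁺ (suc m) e p (fs i) pi with p fz
  ... | true  = there (selectEdges⁺ m (λ j → e (fs j)) (λ j → p (fs j)) i pi)
  ... | false = selectEdges⁺ m (λ j → e (fs j)) (λ j → p (fs j)) i pi

  selectEdges⁻ : ∀ m (e : Fin m → VSet n) p {f} → f ∈ selectEdges m e p → ∃[ i ] p i ≡ true × f ≡ e i
  selectEdges⁻ (suc m) e p f∈ with p fz in p0
  selectEdges⁻ (suc m) e p (here refl) | true = fz , p0 , refl
  selectEdges⁻ (suc m) e p (there f∈)  | true with selectEdges⁻ m (λ j → e (fs j)) (λ j → p (fs j)) f∈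
  ... | i , pi , f≡ = fs i , pi , f≡
  selectEdges⁻ (suc m) e p f∈ | false with selectEdges⁻ m (λ j → e (fs j)) (λ j → p (fs j)) f∈
  ... | i , pi , f≡ = fs i , pi , f≡

  selectEdges-cong : ∀ m (e : Fin m → VSet n) {p q} → (∀ i → p i ≡ q i) → selectEdges m e p ≡ selectEdges m e q
  selectEdges-cong zero    e eq = refl
  selectEdges-cong (suc m) e {p} {q} eq rewrite eq fz =
    cong ((if q fz then e fz ∷ [] else []) ++_) (selectEdges-cong m (λ i → e (fs i)) (λ i → eq (fs i)))

  lookup-⋃-selectEdges : ∀ m (e : Fin m → VSet n) p v →
                         lookup (⋃ (selectEdges m e p)) v ≡ anyFinᵇ m (λ i → p i ∧ lookup (e i) v)
  lookup-⋃-selectEdges zero    e p v = lookup-∅ v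
  lookup-⋃-selectEdges (suc m) e p v with p fz
  ... | true  = trans (lookup-∪ (e fz) _ v)
                      (cong (lookup (e fz) v ∨_) (lookup-⋃-selectEdges m (λ j → e (fs j)) (λ j → p (fs j)) v))
  ... | false = lookup-⋃-selectEdges m (λ j → e (fs j)) (λ j → p (fs j)) v

  -- Consecutive edges may not be one in A and the other in B.
  compatible : Label → Label → Bool
  compatible inA inB = false
  compatible inB inA = false
  compatible _   _   = true

  firstLabel : ∀ m → (Fin m → Label) → Label
  firstLabel zero    g = none
  firstLabel (suc m) g = g fz

  -- t = r - 2: consecutive edges start s = r - 1 vertices apart.
  module Path (t : ℕ) where

    open ≡-Reasoning

    s : ℕ
    s = suc t

    H : ℕ → Hypergraph
    H m = pathHyp m (suc (suc t))

    edge : ∀ m → Fin m → VSet (suc (m * s))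
    edge m = Hypergraph.edge (H m)

    -- crosses i v: edge i contains both v and v - 1
    inEdge crosses : ℕ → ℕ → Bool
    inEdge  i v = (i * s ≤ᵇ v) ∧ (v ≤ᵇ i * s + s)
    crosses i v = (i * s <ᵇ v) ∧ (v ≤ᵇ i * s + s)

    lookup-edge : ∀ m i v → lookup (edge m i) v ≡ inEdge (toℕ i) (toℕ v)
    lookup-edge m i v = lookup∘tabulate (λ v → inEdge (toℕ i) (toℕ v)) v

    crossed covered : ∀ m → (Fin m → Bool) → ℕ → Bool
    crossed m p v = anyFinᵇ m (λ i → p i ∧ crosses (toℕ i) v)
    covered m p v = anyFinᵇ m (λ i → p i ∧ inEdge  (toℕ i) v)

    inEdge⇒crosses : ∀ i {u v w} → inEdge i u ≡ true → inEdge i w ≡ true → w < v → v ≤ u → crosses i v ≡ true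
    inEdge⇒crosses i {u} u∈i w∈i w<v v≤u =
      cong₂ _∧_ (<⇒<ᵇ≡true (≤-<-trans (≤ᵇ≡true⇒≤ (∧≡true⇒ˡ w∈i)) w<v))
                (≤⇒≤ᵇ≡true (≤-trans v≤u (≤ᵇ≡true⇒≤ (∧≡true⇒ʳ {i * s ≤ᵇ u} u∈i))))

    -- Components of a sub-path are intervals: v is least in its component iff no selected edge crosses it.
    crossed⇒¬isRep : ∀ m p v → crossed m p (toℕ v) ≡ true → isRep (selectEdges m (edge m) p) v ≡ false
    crossed⇒¬isRep m p v crossed-v with anyFinᵇ⁻ m _ crossed-v
    ... | i , pi∧crosses = isRep-false (selectEdges⁺ m (edge m) p i (∧≡true⇒ˡ pi∧crosses)) v∈ w∈ w<v
      where
      crosses-v : crosses (toℕ i) (toℕ v) ≡ true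
      crosses-v = ∧≡true⇒ʳ {p i} pi∧crosses
      is<v : toℕ i * s < toℕ v
      is<v = <ᵇ≡true⇒< (∧≡true⇒ˡ crosses-v)
      w<n : toℕ i * s < suc (m * s)
      w<n = <-trans is<v (toℕ<n v)
      w : Fin (suc (m * s))
      w = fromℕ< w<n
      w<v : toℕ w < toℕ v
      w<v = subst (_< toℕ v) (sym (toℕ-fromℕ< w<n)) is<v
      v∈ : v ∈ᵥ edge m i
      v∈ = trans (lookup-edge m i v)
                 (cong₂ _∧_ (≤⇒≤ᵇ≡true (<⇒≤ is<v)) (∧≡true⇒ʳ {toℕ i * s <ᵇ toℕ v} crosses-v))
      w∈ : w ∈ᵥ edge m i
      w∈ = trans (lookup-edge m i w)
             (subst (λ u → inEdge (toℕ i) u ≡ true) (sym (toℕ-fromℕ< w<n))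
               (cong₂ _∧_ (≤⇒≤ᵇ≡true (≤-refl {toℕ i * s})) (≤⇒≤ᵇ≡true (m≤m+n (toℕ i * s) s))))

    ¬crossed⇒isRep : ∀ m p v → crossed m p (toℕ v) ≡ false → isRep (selectEdges m (edge m) p) v ≡ true
    ¬crossed⇒isRep m p v ¬crossed-v = isRep-true closed
      where
      closed : ∀ {e u w} → e ∈ selectEdges m (edge m) p → u ∈ᵥ e → w ∈ᵥ e → toℕ w < toℕ v → toℕ u < toℕ v
      closed {u = u} {w} e∈ u∈ w∈ w<v with selectEdges⁻ m (edge m) p e∈ | toℕ u <? toℕ v
      ... | _             | yes u<v = u<v
      ... | i , pi , refl | no u≮v
        with () ← trans (sym (anyFinᵇ⁺ m _ i (cong₂ _∧_ pi
                    (inEdge⇒crosses (toℕ i) (trans (sym (lookup-edge m i u)) u∈)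
                                            (trans (sym (lookup-edge m i w)) w∈) w<v (≮⇒≥ u≮v)))))
                        ¬crossed-v

    isRep-path : ∀ m p v → isRep (selectEdges m (edge m) p) v ≡ not (crossed m p (toℕ v))
    isRep-path m p v with crossed m p (toℕ v) in crossed-v
    ... | true  = crossed⇒¬isRep m p v crossed-v
    ... | false = ¬crossed⇒isRep m p v crossed-v

    partialCount sectionCount : ∀ m → (Fin m → Bool) → ℕ
    partialCount m p = countBelow (suc (m * s)) (λ v → not (crossed m p v))
    sectionCount m p = countBelow (suc (m * s)) (λ v → covered m p v ∧ not (crossed m p v))

    kPartial-path : ∀ m (g : Fin m → Label) → kPartial (H m) g ≡ partialCount m (isAB ∘ g)
    kPartial-path m g =
      trans (countᵇ-cong (λ v → cong₂ _∧_ (lookup-replicate v true) (isRep-path m (λ i → isAB (g i)) v)))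
            (countᵇ-toℕ (suc (m * s)) (λ v → not (crossed m (λ i → isAB (g i)) v)))

    kSection-path : ∀ m (g : Fin m → Label) → kSection (H m) g ≡ sectionCount m (isB ∘ g)
    kSection-path m g = trans (countᵇ-cong (λ v → cong₂ _∧_ (covered-⋃ v) (isRep-path m (λ i → isB (g i)) v)))
                              (countᵇ-toℕ (suc (m * s))
                                (λ v → covered m (λ i → isB (g i)) v ∧ not (crossed m (λ i → isB (g i)) v)))
      where
      covered-⋃ : ∀ v → lookup (⋃ (edgesB (H m) g)) v ≡ covered m (λ i → isB (g i)) (toℕ v)
      covered-⋃ v = trans (lookup-⋃-selectEdges m (edge m) (λ i → isB (g i)) v)
                          (anyFinᵇ-cong m (λ i → cong (isB (g i) ∧_) (lookup-edge m i v)))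

    -- Removing the first edge: its vertices below s leave, and the others are renumbered by s.
    crosses-shift : ∀ i u → crosses (suc i) (s + u) ≡ crosses i u
    crosses-shift i u = cong₂ _∧_ (+-cancelˡ-<ᵇ s (i * s) u)
                                  (trans (cong (s + u ≤ᵇ_) (+-assoc s (i * s) s)) (+-cancelˡ-≤ᵇ s u (i * s + s)))

    inEdge-shift : ∀ i u → inEdge (suc i) (s + u) ≡ inEdge i u
    inEdge-shift i u = cong₂ _∧_ (+-cancelˡ-≤ᵇ s (i * s) u)
                                 (trans (cong (s + u ≤ᵇ_) (+-assoc s (i * s) s)) (+-cancelˡ-≤ᵇ s u (i * s + s)))

    crosses-below : ∀ i {v} → v < s → crosses (suc i) v ≡ false
    crosses-below i {v} v<s rewrite ≮⇒<ᵇ≡false {s + i * s} {v} (λ lt → <-asym v<s (≤-<-trans (m≤m+n s (i * s)) lt)) = refl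

    inEdge-below : ∀ i {v} → v < s → inEdge (suc i) v ≡ false
    inEdge-below i {v} v<s rewrite ≰⇒≤ᵇ≡false {s + i * s} {v} (λ le → <⇒≱ v<s (≤-trans (m≤m+n s (i * s)) le)) = refl

    s+u≤ᵇs : ∀ u → (s + u ≤ᵇ s) ≡ (u ≤ᵇ 0)
    s+u≤ᵇs zero    = ≤⇒≤ᵇ≡true (≤-reflexive (+-identityʳ s))
    s+u≤ᵇs (suc u) = ≰⇒≤ᵇ≡false (<⇒≱ (m<m+n s z<s))

    crossed-zero : ∀ m p → crossed m p 0 ≡ false
    crossed-zero m p = anyFinᵇ-false m _ (λ i → ∧-zeroʳ (p i))

    covered-zero : ∀ m (g : Fin m → Label) → covered m (isB ∘ g) 0 ≡ isB (firstLabel m g)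
    covered-zero zero    g = refl
    covered-zero (suc m) g =
      trans (cong₂ _∨_ (∧-identityʳ (isB (g fz))) (anyFinᵇ-false m _ (λ i → ∧-zeroʳ (isB (g (fs i))))))
            (∨-identityʳ _)

    crossed-shift : ∀ m p u → crossed (suc m) p (s + u) ≡ (p fz ∧ (u ≤ᵇ 0)) ∨ crossed m (tail p) u
    crossed-shift m p u = cong₂ _∨_ (cong (p fz ∧_) (s+u≤ᵇs u))
                                    (anyFinᵇ-cong m (λ i → cong (p (fs i) ∧_) (crosses-shift (toℕ i) u)))

    covered-shift : ∀ m p u → covered (suc m) p (s + u) ≡ (p fz ∧ (u ≤ᵇ 0)) ∨ covered m (tail p) u
    covered-shift m p u = cong₂ _∨_ (cong (p fz ∧_) (s+u≤ᵇs u))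
                                    (anyFinᵇ-cong m (λ i → cong (p (fs i) ∧_) (inEdge-shift (toℕ i) u)))

    crossed-below : ∀ m p {v} → v < s → crossed (suc m) p v ≡ p fz ∧ crosses 0 v
    crossed-below m p {v} v<s =
      trans (cong (p fz ∧ crosses 0 v ∨_)
                  (anyFinᵇ-false m _ (λ i → trans (cong (p (fs i) ∧_) (crosses-below (toℕ i) v<s)) (∧-zeroʳ _))))
            (∨-identityʳ _)

    covered-below : ∀ m p {v} → v < s → covered (suc m) p v ≡ p fz
    covered-below m p {v} v<s =
      trans (cong₂ _∨_ (trans (cong (p fz ∧_) (≤⇒≤ᵇ≡true (<⇒≤ v<s))) (∧-identityʳ _))
                       (anyFinᵇ-false m _ (λ i → trans (cong (p (fs i) ∧_) (inEdge-below (toℕ i) v<s)) (∧-zeroʳ _))))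
            (∨-identityʳ _)

    countBelow-split : ∀ k q → countBelow (suc (s + k)) q ≡ countBelow s q + countBelow (suc k) (λ u → q (s + u))
    countBelow-split k q = trans (cong (λ N → countBelow N q) (sym (+-suc s k))) (countBelow-+ s (suc k) q)

    -- of the vertices below s, edge 0 crosses all but vertex 0
    uncrossed-first : countBelow s (λ v → not (crosses 0 v)) ≡ 1
    uncrossed-first =
      cong suc (trans (countBelow-cong t (λ w w<t → cong not (≤⇒≤ᵇ≡true (s≤s (<⇒≤ w<t))))) (countBelow-false t))

    partialCount-first : ∀ c → countBelow s (λ v → not (c ∧ crosses 0 v)) ≡ (if c then 1 else s)
    partialCount-first true  = uncrossed-first
    partialCount-first false = countBelow-true s

    sectionCount-first : ∀ c → countBelow s (λ v → c ∧ not (c ∧ crosses 0 v)) ≡ indicator c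
    sectionCount-first true  = uncrossed-first
    sectionCount-first false = countBelow-false s

    partialCount-suc : ∀ m p → partialCount (suc m) p ≡
                       (if p fz then partialCount m (tail p) else s + partialCount m (tail p))
    partialCount-suc m p = begin
        countBelow (suc (s + m * s)) (λ v → not (crossed (suc m) p v))
      ≡⟨ countBelow-split (m * s) (λ v → not (crossed (suc m) p v)) ⟩
        countBelow s (λ v → not (crossed (suc m) p v))
          + countBelow (suc (m * s)) (λ u → not (crossed (suc m) p (s + u)))
      ≡⟨ cong₂ _+_ (trans (countBelow-cong s (λ v v<s → cong not (crossed-below m p v<s))) (partialCount-first (p fz)))
                   (countBelow-cong (suc (m * s)) (λ u _ → cong not (crossed-shift m p u))) ⟩
        (if p fz then 1 else s) + countBelow (suc (m * s)) (λ u → not ((p fz ∧ (u ≤ᵇ 0)) ∨ crossed m (tail p) u))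
      ≡⟨ merge (p fz) ⟩
        (if p fz then partialCount m (tail p) else s + partialCount m (tail p)) ∎
      where
      -- with p fz, the shared vertex s is crossed by the first edge instead of being a representative of the tail
      merge : ∀ c → (if c then 1 else s) + countBelow (suc (m * s)) (λ u → not ((c ∧ (u ≤ᵇ 0)) ∨ crossed m (tail p) u))
                    ≡ (if c then partialCount m (tail p) else s + partialCount m (tail p))
      merge true rewrite crossed-zero m (tail p) = refl
      merge false = refl

    sectionCount-suc : ∀ m p → sectionCount (suc m) p ≡
                       (if p fz then (if covered m (tail p) 0 then sectionCount m (tail p) else suc (sectionCount m (tail p)))
                        else sectionCount m (tail p))
    sectionCount-suc m p = begin
        countBelow (suc (s + m * s)) (λ v → covered (suc m) p v ∧ not (crossed (suc m) p v))
      ≡⟨ countBelow-split (m * s) (λ v → covered (suc m) p v ∧ not (crossed (suc m) p v)) ⟩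
        countBelow s (λ v → covered (suc m) p v ∧ not (crossed (suc m) p v))
          + countBelow (suc (m * s)) (λ u → covered (suc m) p (s + u) ∧ not (crossed (suc m) p (s + u)))
      ≡⟨ cong₂ _+_ (trans (countBelow-cong s (λ v v<s →
                             cong₂ (λ a b → a ∧ not b) (covered-below m p v<s) (crossed-below m p v<s)))
                          (sectionCount-first (p fz)))
                   (countBelow-cong (suc (m * s)) (λ u _ →
                      cong₂ (λ a b → a ∧ not b) (covered-shift m p u) (crossed-shift m p u))) ⟩
        indicator (p fz) + countBelow (suc (m * s))
          (λ u → ((p fz ∧ (u ≤ᵇ 0)) ∨ covered m (tail p) u) ∧ not ((p fz ∧ (u ≤ᵇ 0)) ∨ crossed m (tail p) u))
      ≡⟨ merge (p fz) ⟩
        _ ∎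
      where
      merge : ∀ c → indicator c + countBelow (suc (m * s))
                      (λ u → ((c ∧ (u ≤ᵇ 0)) ∨ covered m (tail p) u) ∧ not ((c ∧ (u ≤ᵇ 0)) ∨ crossed m (tail p) u))
                    ≡ (if c then (if covered m (tail p) 0 then sectionCount m (tail p) else suc (sectionCount m (tail p)))
                       else sectionCount m (tail p))
      merge true rewrite crossed-zero m (tail p) with covered m (tail p) 0
      ... | true  = refl
      ... | false = refl
      merge false = refl

    kPartial-suc : ∀ m (h : Fin (suc m) → Label) → kPartial (H (suc m)) h ≡
                   (if isAB (h fz) then kPartial (H m) (tail h) else s + kPartial (H m) (tail h))
    kPartial-suc m h rewrite kPartial-path (suc m) h | kPartial-path m (tail h) = partialCount-suc m (isAB ∘ h)

    kSection-suc : ∀ m (h : Fin (suc m) → Label) → kSection (H (suc m)) h ≡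
                   (if isB (h fz)
                    then (if isB (firstLabel m (tail h)) then kSection (H m) (tail h) else suc (kSection (H m) (tail h)))
                    else kSection (H m) (tail h))
    kSection-suc m h rewrite kSection-path (suc m) h | kSection-path m (tail h) | sym (covered-zero m (tail h)) =
      sectionCount-suc m (isB ∘ h)

    adjacent : ℕ → ℕ → Bool
    adjacent i j = (i ≤ᵇ suc j) ∧ (j ≤ᵇ suc i)

    adjacent-suc : ∀ i j → adjacent (suc i) (suc j) ≡ adjacent i j
    adjacent-suc i j = cong₂ _∧_ (<ᵇ-suc i (suc j)) (<ᵇ-suc j (suc i))

    inEdge⇒≤suc : ∀ i j {v} → inEdge i v ≡ true → inEdge j v ≡ true → i ≤ suc j
    inEdge⇒≤suc i j {v} v∈i v∈j = *-cancelʳ-≤ i (suc j) s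
      (≤-trans (≤ᵇ≡true⇒≤ (∧≡true⇒ˡ v∈i))
               (≤-trans (≤ᵇ≡true⇒≤ (∧≡true⇒ʳ {j * s ≤ᵇ v} v∈j)) (≤-reflexive (+-comm (j * s) s))))

    inEdge-start : ∀ i j → i ≤ j → j ≤ suc i → inEdge i (j * s) ≡ true
    inEdge-start i j i≤j j≤1+i = cong₂ _∧_ (≤⇒≤ᵇ≡true (*-monoˡ-≤ s i≤j))
                                          (≤⇒≤ᵇ≡true (≤-trans (*-monoˡ-≤ s j≤1+i) (≤-reflexive (+-comm s (i * s)))))

    meets-edge : ∀ m (i j : Fin m) → meets (edge m i) (edge m j) ≡ adjacent (toℕ i) (toℕ j)
    meets-edge m i j = ⇔→≡ {z = true} (mk⇔ to from)
      where
      to : meets (edge m i) (edge m j) ≡ true → adjacent (toℕ i) (toℕ j) ≡ true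
      to eq with meets⁻ {e = edge m i} eq
      ... | v , v∈i , v∈j =
        let v∈i′ = trans (sym (lookup-edge m i v)) v∈i
            v∈j′ = trans (sym (lookup-edge m j v)) v∈j
        in cong₂ _∧_ (≤⇒≤ᵇ≡true (inEdge⇒≤suc (toℕ i) (toℕ j) v∈i′ v∈j′))
                     (≤⇒≤ᵇ≡true (inEdge⇒≤suc (toℕ j) (toℕ i) v∈j′ v∈i′))
      start : Fin m → Fin (suc (m * s))
      start l = fromℕ< (s≤s (*-monoˡ-≤ s (<⇒≤ (toℕ<n l))))
      start∈ : ∀ (k l : Fin m) → toℕ k ≤ toℕ l → toℕ l ≤ suc (toℕ k) → start l ∈ᵥ edge m k
      start∈ k l k≤l l≤1+k = trans (lookup-edge m k (start l))
        (subst (λ u → inEdge (toℕ k) u ≡ true) (sym (toℕ-fromℕ< _)) (inEdge-start (toℕ k) (toℕ l) k≤l l≤1+k))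
      -- the common vertex is the start of the later edge
      from : adjacent (toℕ i) (toℕ j) ≡ true → meets (edge m i) (edge m j) ≡ true
      from adj with toℕ i ≤? toℕ j
      ... | yes i≤j = meets⁺ (edge m i) (edge m j) (start j)
                        (start∈ i j i≤j (≤ᵇ≡true⇒≤ (∧≡true⇒ʳ {toℕ i ≤ᵇ suc (toℕ j)} adj)))
                        (start∈ j j ≤-refl (n≤1+n _))
      ... | no i≰j  = meets⁺ (edge m i) (edge m j) (start i)
                        (start∈ i i ≤-refl (n≤1+n _))
                        (start∈ j i (<⇒≤ (≰⇒> i≰j)) (≤ᵇ≡true⇒≤ (∧≡true⇒ˡ adj)))

    noConflict : (Fin m → Label) → Fin m → Fin m → Bool
    noConflict g i j = not (isA (g i) ∧ isB (g j) ∧ adjacent (toℕ i) (toℕ j))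

    disjointAdjacent : ∀ m → (Fin m → Label) → Bool
    disjointAdjacent m g = allFinᵇ m (λ i → allFinᵇ m (λ j → noConflict g i j))

    vertexDisjoint-path : ∀ m g → vertexDisjoint (H m) g ≡ disjointAdjacent m g
    vertexDisjoint-path m g = allFinᵇ-cong m (λ i → allFinᵇ-cong m (λ j →
      cong (λ b → not (isA (g i) ∧ isB (g j) ∧ b)) (meets-edge m i j)))

    nonAdjacent : ∀ a b → not (a ∧ b ∧ false) ≡ true
    nonAdjacent a b rewrite ∧-zeroʳ b | ∧-zeroʳ a = refl

    -- Only edge 1 is adjacent to edge 0.
    firstEdge-noConflict : ∀ m (h : Fin (suc m) → Label) →
      (noConflict h fz fz ∧ allFinᵇ m (λ j → noConflict h fz (fs j))) ∧ allFinᵇ m (λ i → noConflict h (fs i) fz)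
        ≡ compatible (h fz) (firstLabel m (tail h))
    firstEdge-noConflict zero h with h fz
    ... | none = refl
    ... | inA  = refl
    ... | inB  = refl
    firstEdge-noConflict (suc m) h
      rewrite allFinᵇ-true m (λ j → noConflict h fz (fs (fs j))) (λ j → nonAdjacent (isA (h fz)) (isB (h (fs (fs j)))))
            | allFinᵇ-true m (λ i → noConflict h (fs (fs i)) fz) (λ i → nonAdjacent (isA (h (fs (fs i)))) (isB (h fz)))
      with h fz | h (fs fz)
    ... | none | none = refl
    ... | none | inA  = refl
    ... | none | inB  = refl
    ... | inA  | none = refl
    ... | inA  | inA  = refl
    ... | inA  | inB  = refl
    ... | inB  | none = refl
    ... | inB  | inA  = refl
    ... | inB  | inB  = refl

    disjointAdjacent-suc : ∀ m (h : Fin (suc m) → Label) →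
      disjointAdjacent (suc m) h ≡ compatible (h fz) (firstLabel m (tail h)) ∧ disjointAdjacent m (tail h)
    disjointAdjacent-suc m h = begin
        (noConflict h fz fz ∧ row)
          ∧ allFinᵇ m (λ i → noConflict h (fs i) fz ∧ allFinᵇ m (λ j → noConflict h (fs i) (fs j)))
      ≡⟨ cong ((noConflict h fz fz ∧ row) ∧_) (allFinᵇ-∧ m _ _) ⟩
        (noConflict h fz fz ∧ row) ∧ (column ∧ allFinᵇ m (λ i → allFinᵇ m (λ j → noConflict h (fs i) (fs j))))
      ≡⟨ sym (∧-assoc (noConflict h fz fz ∧ row) column _) ⟩
        ((noConflict h fz fz ∧ row) ∧ column) ∧ allFinᵇ m (λ i → allFinᵇ m (λ j → noConflict h (fs i) (fs j)))
      ≡⟨ cong₂ _∧_ (firstEdge-noConflict m h) (allFinᵇ-cong m (λ i → allFinᵇ-cong m (λ j →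
           cong (λ b → not (isA (h (fs i)) ∧ isB (h (fs j)) ∧ b)) (adjacent-suc (toℕ i) (toℕ j))))) ⟩
        compatible (h fz) (firstLabel m (tail h)) ∧ disjointAdjacent m (tail h) ∎
      where
      row column : Bool
      row    = allFinᵇ m (λ j → noConflict h fz (fs j))
      column = allFinᵇ m (λ i → noConflict h (fs i) fz)

    vertexDisjoint-suc : ∀ m (h : Fin (suc m) → Label) → vertexDisjoint (H (suc m)) h
                         ≡ compatible (h fz) (firstLabel m (tail h)) ∧ vertexDisjoint (H m) (tail h)
    vertexDisjoint-suc m h = begin
        vertexDisjoint (H (suc m)) h
      ≡⟨ vertexDisjoint-path (suc m) h ⟩
        disjointAdjacent (suc m) h
      ≡⟨ disjointAdjacent-suc m h ⟩
        compatible (h fz) (firstLabel m (tail h)) ∧ disjointAdjacent m (tail h)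
      ≡⟨ cong (compatible (h fz) (firstLabel m (tail h)) ∧_) (sym (vertexDisjoint-path m (tail h))) ⟩
        compatible (h fz) (firstLabel m (tail h)) ∧ vertexDisjoint (H m) (tail h) ∎

    -- The truncated subtractions in ξ never truncate. The indicator: if edge 0 is not in B,
    -- vertex 0 is a component of H_{A⊔B} that H × B lacks.
    kSection+≤kPartial : ∀ m g → vertexDisjoint (H m) g ≡ true →
                         kSection (H m) g + indicator (not (isB (firstLabel m g))) ≤ kPartial (H m) g
    kSection+≤kPartial zero    g _  = s≤s z≤n
    kSection+≤kPartial (suc m) h vd =
      subst₂ _≤_ (cong (_+ indicator (not (isB (h fz)))) (sym (kSection-suc m h))) (sym (kPartial-suc m h))
        (extend (h fz) (firstLabel m (tail h)) (∧≡true⇒ˡ vd′)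
                (kSection+≤kPartial m (tail h) (∧≡true⇒ʳ {compatible (h fz) _} vd′)))
      where
      vd′ : compatible (h fz) (firstLabel m (tail h)) ∧ vertexDisjoint (H m) (tail h) ≡ true
      vd′ = trans (sym (vertexDisjoint-suc m h)) vd
      extend : ∀ l l′ {kS kP} → compatible l l′ ≡ true → kS + indicator (not (isB l′)) ≤ kP →
               (if isB l then (if isB l′ then kS else suc kS) else kS) + indicator (not (isB l)) ≤ (if isAB l then kP else s + kP)
      extend none l′   {kS} _ ≤kP = ≤-trans (≤-reflexive (+-comm kS 1)) (+-mono-≤ (s≤s z≤n) (≤-trans (m≤m+n kS _) ≤kP))
      extend inA none  _ ≤kP = ≤kP
      extend inA inA   _ ≤kP = ≤kP
      extend inB none  {kS} _ ≤kP = ≤-trans (≤-reflexive (trans (+-identityʳ (suc kS)) (+-comm 1 kS))) ≤kP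
      extend inB inB   _ ≤kP = ≤kP

    kSection≤kPartial : ∀ m g → vertexDisjoint (H m) g ≡ true → kSection (H m) g ≤ kPartial (H m) g
    kSection≤kPartial m g vd = ≤-trans (m≤m+n _ _) (kSection+≤kPartial m g vd)

    kSection≤sizeAB : ∀ m g → kSection (H m) g ≤ sizeAB (H m) g
    kSection≤sizeAB zero    g = z≤n
    kSection≤sizeAB (suc m) h = subst (_≤ sizeAB (H (suc m)) h) (sym (kSection-suc m h))
      (extend (h fz) (firstLabel m (tail h)) (kSection≤sizeAB m (tail h)))
      where
      extend : ∀ l l′ {kS n} → kS ≤ n → (if isB l then (if isB l′ then kS else suc kS) else kS) ≤ indicator (isAB l) + n
      extend none l′   ≤n = ≤n
      extend inA  l′   ≤n = ≤-trans ≤n (n≤1+n _)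
      extend inB none  ≤n = s≤s ≤n
      extend inB inA   ≤n = s≤s ≤n
      extend inB inB   ≤n = ≤-trans ≤n (n≤1+n _)

module Sums {c ℓ : Level} (R : CommutativeRing c ℓ) where

  open import Data.List using (map; concatMap)
  open import Data.List.Properties using (map-++)
  open import Data.Maybe using (nothing)
  open import Relation.Binary.PropositionalEquality as ≡ using (_≡_; _≗_)
  open import Tactic.RingSolver.Core.AlmostCommutativeRing using (fromCommutativeRing)
  import Tactic.RingSolver.NonReflective as RingSolver
  open CommutativeRing R
  open Poly R using (sumL)

  sumL-++ : ∀ (as bs : List Carrier) → sumL (as ++ bs) ≈ sumL as + sumL bs
  sumL-++ []       bs = sym (+-identityˡ _)
  sumL-++ (a ∷ as) bs = trans (+-cong refl (sumL-++ as bs)) (sym (+-assoc a _ _))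

  sumL-concatMap : ∀ {A B : Set} (f : A → Carrier) (F : B → List A) (bs : List B) →
                   sumL (map f (concatMap F bs)) ≈ sumL (map (λ b → sumL (map f (F b))) bs)
  sumL-concatMap f F []       = refl
  sumL-concatMap f F (b ∷ bs) = trans (reflexive (≡.cong sumL (map-++ f (F b) (concatMap F bs))))
                                      (trans (sumL-++ (map f (F b)) _) (+-cong refl (sumL-concatMap f F bs)))

  sumL-cong : ∀ {A : Set} {f g : A → Carrier} (as : List A) → (∀ a → f a ≈ g a) → sumL (map f as) ≈ sumL (map g as)
  sumL-cong []       eq = refl
  sumL-cong (a ∷ as) eq = +-cong (eq a) (sumL-cong as eq)

  sumL-linear : ∀ {A : Set} u v (f g : A → Carrier) (as : List A) →
                sumL (map (λ a → u * f a + v * g a) as) ≈ u * sumL (map f as) + v * sumL (map g as)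
  sumL-linear u v f g []       = sym (trans (+-cong (zeroʳ u) (zeroʳ v)) (+-identityʳ 0#))
  sumL-linear u v f g (a ∷ as) = trans (+-cong refl (sumL-linear u v f g as)) (interchange u v (f a) (g a) _ _)
    where
    open RingSolver (fromCommutativeRing R (λ _ → nothing)) using (solve; _⊜_; _⊕_; _⊗_)
    interchange : ∀ u v a b c d → (u * a + v * b) + (u * c + v * d) ≈ u * (a + c) + v * (b + d)
    interchange = solve 6 (λ u v a b c d →
      ((u ⊗ a ⊕ v ⊗ b) ⊕ (u ⊗ c ⊕ v ⊗ d)) ⊜ (u ⊗ (a ⊕ c) ⊕ v ⊗ (b ⊕ d))) refl

  RespectsPointwise : ∀ {N} → ((Fin N → Label) → Carrier) → Set ℓ
  RespectsPointwise f = ∀ {g h} → g ≗ h → f g ≈ f h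

  sumFirst : ∀ {N} → ((Fin (suc N) → Label) → Carrier) → (Fin N → Label) → Carrier
  sumFirst f g = f (none ∷ᶠ g) + (f (inA ∷ᶠ g) + f (inB ∷ᶠ g))

  ∷ᶠ-cong : ∀ {N} l {g h : Fin N → Label} → g ≗ h → (l ∷ᶠ g) ≗ (l ∷ᶠ h)
  ∷ᶠ-cong l eq fz     = ≡.refl
  ∷ᶠ-cong l eq (fs i) = eq i

  sumFirst-cong : ∀ {N} {f : (Fin (suc N) → Label) → Carrier} → RespectsPointwise f → RespectsPointwise (sumFirst f)
  sumFirst-cong f-cong eq =
    +-cong (f-cong (∷ᶠ-cong none eq)) (+-cong (f-cong (∷ᶠ-cong inA eq)) (f-cong (∷ᶠ-cong inB eq)))

  -- allLabellings conses a label onto a labelling with a local function, equal to _∷ᶠ_ only pointwise.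
  sumL-allLabellings-suc : ∀ N {f : (Fin (suc N) → Label) → Carrier} → RespectsPointwise f →
                           sumL (map f (allLabellings (suc N))) ≈ sumL (map (sumFirst f) (allLabellings N))
  sumL-allLabellings-suc N f-cong = trans (sumL-concatMap _ _ (allLabellings N))
    (sumL-cong (allLabellings N) (λ g →
      +-cong (f-cong (λ { fz → ≡.refl ; (fs i) → ≡.refl }))
        (+-cong (f-cong (λ { fz → ≡.refl ; (fs i) → ≡.refl }))
          (trans (+-identityʳ _) (f-cong (λ { fz → ≡.refl ; (fs i) → ≡.refl }))))))

module PathRecurrence {c ℓ : Level} (R : CommutativeRing c ℓ) (t : ℕ) (x y z : CommutativeRing.Carrier R) where

  open import Algebra.Properties.Semiring.Exp using (^-homo-*)
  open import Data.List using (map)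
  open import Data.Maybe using (nothing)
  open import Data.Nat using () renaming (_+_ to _+ℕ_)
  open import Data.Nat.Properties using (+-∸-assoc)
  open import Data.Vec using (replicate)
  open import Relation.Binary.PropositionalEquality as ≡ using (_≡_)
  open import Tactic.RingSolver.Core.AlmostCommutativeRing using (fromCommutativeRing)
  import Tactic.RingSolver.NonReflective as RingSolver

  open CommutativeRing R
  open Poly R using (_^_; sumL; ξ)
  open Sums R
  open Combinatorics using (indicator; compatible; firstLabel; countᵇ-cong; allFinᵇ-cong; selectEdges-cong)
  open Combinatorics.Path t
  open RingSolver (fromCommutativeRing R (λ _ → nothing)) using (solve; _⊜_; _⊕_; _⊗_)
  open import Relation.Binary.Reasoning.Setoid setoid
  open import Algebra.Solver.CommutativeMonoid *-commutativeMonoid using ()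
    renaming (solve to monoid-solve; _⊜_ to _⊜ₘ_; _⊕_ to _·_)

  monomial : Bool → ℕ → ℕ → ℕ → Carrier
  monomial V kP kS n = if V then x ^ (kP ∸ kS) * y ^ (n ∸ kS) * z ^ kS else 0#

  term : ∀ m → (Fin m → Label) → Carrier
  term m g = monomial (vertexDisjoint (H m) g) (kPartial (H m) g) (kSection (H m) g) (sizeAB (H m) g)

  monomial-cong : ∀ {V V′ kP kP′ kS kS′ n n′} → V ≡ V′ → kP ≡ kP′ → kS ≡ kS′ → n ≡ n′ →
                  monomial V kP kS n ≡ monomial V′ kP′ kS′ n′
  monomial-cong ≡.refl ≡.refl ≡.refl ≡.refl = ≡.refl

  term-cong : ∀ m → RespectsPointwise (term m)
  term-cong m eq = reflexive (monomial-cong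
    (allFinᵇ-cong m (λ i → allFinᵇ-cong m (λ j →
      ≡.cong₂ (λ u w → not (isA u ∧ isB w ∧ meets (edge m i) (edge m j))) (eq i) (eq j))))
    (≡.cong (k (replicate _ true)) (selectEdges-cong m (edge m) (λ i → ≡.cong isAB (eq i))))
    (≡.cong (λ E → k (⋃ E) E) (selectEdges-cong m (edge m) (λ i → ≡.cong isB (eq i))))
    (countᵇ-cong (λ i → ≡.cong isAB (eq i))))

  term-suc : ∀ m (h : Fin (suc m) → Label) → term (suc m) h ≡
    monomial (compatible (h fz) (firstLabel m (tail h)) ∧ vertexDisjoint (H m) (tail h))
             (if isAB (h fz) then kPartial (H m) (tail h) else s +ℕ kPartial (H m) (tail h))
             (if isB (h fz)
              then (if isB (firstLabel m (tail h)) then kSection (H m) (tail h) else suc (kSection (H m) (tail h)))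
              else kSection (H m) (tail h))
             (indicator (isAB (h fz)) +ℕ sizeAB (H m) (tail h))
  term-suc m h = monomial-cong (vertexDisjoint-suc m h) (kPartial-suc m h) (kSection-suc m h) ≡.refl

  monomial-x : ∀ V kP kS n → (V ≡ true → kS ≤ kP) → monomial V (s +ℕ kP) kS n ≈ x ^ s * monomial V kP kS n
  monomial-x false kP kS n _     = sym (zeroʳ _)
  monomial-x true  kP kS n kS≤kP rewrite +-∸-assoc s (kS≤kP ≡.refl) = begin
      x ^ (s +ℕ (kP ∸ kS)) * y ^ (n ∸ kS) * z ^ kS
    ≈⟨ *-cong (*-cong (^-homo-* semiring x s (kP ∸ kS)) refl) refl ⟩
      x ^ s * x ^ (kP ∸ kS) * y ^ (n ∸ kS) * z ^ kS
    ≈⟨ monoid-solve 4 (λ a b c d → ((a · b) · c) · d ⊜ₘ a · ((b · c) · d)) refl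
                     (x ^ s) (x ^ (kP ∸ kS)) (y ^ (n ∸ kS)) (z ^ kS) ⟩
      x ^ s * (x ^ (kP ∸ kS) * y ^ (n ∸ kS) * z ^ kS) ∎

  monomial-y : ∀ V kP kS n → kS ≤ n → monomial V kP kS (suc n) ≈ y * monomial V kP kS n
  monomial-y false kP kS n _    = sym (zeroʳ _)
  monomial-y true  kP kS n kS≤n rewrite +-∸-assoc 1 kS≤n =
    monoid-solve 4 (λ a b c d → (a · (b · c)) · d ⊜ₘ b · ((a · c) · d)) refl (x ^ (kP ∸ kS)) y (y ^ (n ∸ kS)) (z ^ kS)

  monomial-z : ∀ V kP kS n → (V ≡ true → kS ≤ kP) → monomial V (s +ℕ kP) (suc kS) (suc n) ≈ z * x ^ t * monomial V kP kS n
  monomial-z false kP kS n _     = sym (zeroʳ _)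
  monomial-z true  kP kS n kS≤kP rewrite +-∸-assoc t (kS≤kP ≡.refl) = begin
      x ^ (t +ℕ (kP ∸ kS)) * y ^ (n ∸ kS) * (z * z ^ kS)
    ≈⟨ *-cong (*-cong (^-homo-* semiring x t (kP ∸ kS)) refl) refl ⟩
      x ^ t * x ^ (kP ∸ kS) * y ^ (n ∸ kS) * (z * z ^ kS)
    ≈⟨ monoid-solve 5 (λ a b c d e → ((a · b) · c) · (e · d) ⊜ₘ (e · a) · ((b · c) · d)) refl
                      (x ^ t) (x ^ (kP ∸ kS)) (y ^ (n ∸ kS)) (z ^ kS) z ⟩
      z * x ^ t * (x ^ (kP ∸ kS) * y ^ (n ∸ kS) * z ^ kS) ∎

  term-none∷ : ∀ m g → term (suc m) (none ∷ᶠ g) ≈ x ^ s * term m g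
  term-none∷ m g = trans (reflexive (term-suc m (none ∷ᶠ g))) (monomial-x _ _ _ _ (kSection≤kPartial m g))

  -- In the next three cases edge 0 joins the component of edge 1, or is in A: only |A| + |B| grows.
  term-inA∷none∷ : ∀ m f → term (suc (suc m)) (inA ∷ᶠ none ∷ᶠ f) ≈ y * term (suc m) (none ∷ᶠ f)
  term-inA∷none∷ m f = trans (reflexive (term-suc (suc m) (inA ∷ᶠ none ∷ᶠ f)))
                              (monomial-y _ _ _ _ (kSection≤sizeAB (suc m) (none ∷ᶠ f)))

  term-inA∷inA∷ : ∀ m f → term (suc (suc m)) (inA ∷ᶠ inA ∷ᶠ f) ≈ y * term (suc m) (inA ∷ᶠ f)
  term-inA∷inA∷ m f = trans (reflexive (term-suc (suc m) (inA ∷ᶠ inA ∷ᶠ f)))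
                              (monomial-y _ _ _ _ (kSection≤sizeAB (suc m) (inA ∷ᶠ f)))

  term-inB∷inB∷ : ∀ m f → term (suc (suc m)) (inB ∷ᶠ inB ∷ᶠ f) ≈ y * term (suc m) (inB ∷ᶠ f)
  term-inB∷inB∷ m f = trans (reflexive (term-suc (suc m) (inB ∷ᶠ inB ∷ᶠ f)))
                              (monomial-y _ _ _ _ (kSection≤sizeAB (suc m) (inB ∷ᶠ f)))

  term-inA∷inB∷ : ∀ m f → term (suc (suc m)) (inA ∷ᶠ inB ∷ᶠ f) ≈ 0#
  term-inA∷inB∷ m f = reflexive (term-suc (suc m) (inA ∷ᶠ inB ∷ᶠ f))

  term-inB∷inA∷ : ∀ m f → term (suc (suc m)) (inB ∷ᶠ inA ∷ᶠ f) ≈ 0#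
  term-inB∷inA∷ m f = reflexive (term-suc (suc m) (inB ∷ᶠ inA ∷ᶠ f))

  -- Edge 0 alone in B is a new component of H × B, and covers the vertices 1, …, t of no other edge.
  term-inB∷none∷ : ∀ m f → term (suc (suc m)) (inB ∷ᶠ none ∷ᶠ f) ≈ z * x ^ t * term m f
  term-inB∷none∷ m f = trans (reflexive unfold) (monomial-z _ _ _ _ (kSection≤kPartial m f))
    where
    g : Fin (suc m) → Label
    g = none ∷ᶠ f
    unfold : term (suc (suc m)) (inB ∷ᶠ g) ≡ monomial (vertexDisjoint (H m) f) (s +ℕ kPartial (H m) f)
                                                     (suc (kSection (H m) f)) (suc (sizeAB (H m) f))
    unfold = ≡.trans (term-suc (suc m) (inB ∷ᶠ g))
                     (monomial-cong (vertexDisjoint-suc m g) (kPartial-suc m g) (≡.cong suc (kSection-suc m g))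
                                    (≡.refl {x = suc (sizeAB (H m) f)}))

  sumFirst²-term : ∀ m f → sumFirst (sumFirst (term (suc (suc m)))) f
                           ≈ (x ^ s + y) * sumFirst (term (suc m)) f + z * x ^ t * term m f
  sumFirst²-term m f = begin
      sumFirst (sumFirst (term (suc (suc m)))) f
    ≈⟨ +-cong (+-cong (term-none∷ (suc m) (none ∷ᶠ f)) (+-cong (term-inA∷none∷ m f) (term-inB∷none∷ m f)))
         (+-cong (+-cong (term-none∷ (suc m) (inA ∷ᶠ f))
                         (trans (+-cong (term-inA∷inA∷ m f) (term-inB∷inA∷ m f)) (+-identityʳ _)))
                 (+-cong (term-none∷ (suc m) (inB ∷ᶠ f))
                         (trans (+-cong (term-inA∷inB∷ m f) (term-inB∷inB∷ m f)) (+-identityˡ _)))) ⟩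
      (X * a + (y * a + Z * d)) + ((X * b + y * b) + (X * c′ + y * c′))
    ≈⟨ regroup X y Z a b c′ d ⟩
      (X + y) * (a + (b + c′)) + Z * d ∎
    where
    X Z a b c′ d : Carrier
    X  = x ^ s
    Z  = z * x ^ t
    a  = term (suc m) (none ∷ᶠ f)
    b  = term (suc m) (inA ∷ᶠ f)
    c′ = term (suc m) (inB ∷ᶠ f)
    d  = term m f
    regroup : ∀ X y Z a b c d → (X * a + (y * a + Z * d)) + ((X * b + y * b) + (X * c + y * c)) ≈ (X + y) * (a + (b + c)) + Z * d
    regroup = solve 7 (λ X y Z a b c d →
      ((X ⊗ a ⊕ (y ⊗ a ⊕ Z ⊗ d)) ⊕ ((X ⊗ b ⊕ y ⊗ b) ⊕ (X ⊗ c ⊕ y ⊗ c)))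
        ⊜ ((X ⊕ y) ⊗ (a ⊕ (b ⊕ c)) ⊕ Z ⊗ d)) refl

  ξ-path-recurrence : ∀ m → ξ (H (suc (suc m))) x y z ≈ (x ^ s + y) * ξ (H (suc m)) x y z + z * x ^ t * ξ (H m) x y z
  ξ-path-recurrence m = begin
      sumL (map (term (suc (suc m))) (allLabellings (suc (suc m))))
    ≈⟨ sumL-allLabellings-suc (suc m) (term-cong (suc (suc m))) ⟩
      sumL (map (sumFirst (term (suc (suc m)))) (allLabellings (suc m)))
    ≈⟨ sumL-allLabellings-suc m (sumFirst-cong (term-cong (suc (suc m)))) ⟩
      sumL (map (sumFirst (sumFirst (term (suc (suc m))))) (allLabellings m))
    ≈⟨ sumL-cong (allLabellings m) (sumFirst²-term m) ⟩
      sumL (map (λ f → (x ^ s + y) * sumFirst (term (suc m)) f + z * x ^ t * term m f) (allLabellings m))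
    ≈⟨ sumL-linear (x ^ s + y) (z * x ^ t) (sumFirst (term (suc m))) (term m) (allLabellings m) ⟩
      (x ^ s + y) * sumL (map (sumFirst (term (suc m))) (allLabellings m)) + z * x ^ t * sumL (map (term m) (allLabellings m))
    ≈⟨ +-cong (*-cong refl (sym (sumL-allLabellings-suc m (term-cong (suc m))))) refl ⟩
      (x ^ s + y) * ξ (H (suc m)) x y z + z * x ^ t * ξ (H m) x y z ∎

mainTheorem12 : ∀ {c ℓ : Level} (R : CommutativeRing c ℓ) (r m : ℕ) → 2 ≤ r → 2 < m →
    let open CommutativeRing R in
    let open Poly R using (_^_) in
    let open PathPoly R in
    ∀ (x y z : Carrier) →
      P m r x y z ≈ (x ^ (r ∸ 1) + y) * P (m ∸ 1) r x y z + z * x ^ (r ∸ 2) * P (m ∸ 2) r x y z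
mainTheorem12 R (suc (suc t)) (suc (suc (suc m))) (s≤s (s≤s z≤n)) (s≤s (s≤s (s≤s _))) x y z =
  PathRecurrence.ξ-path-recurrence R t x y z (suc m)
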